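{- Let $n\geq 1$ and let $\mathcal{F}$ be a sunflower-free collection of subsets of $\{1,2,\dots,n\}$. Then \[ |\mathcal{F}|\leq 3(n+1)\sum_{0\le k\leq n/3}\binom{n}{k}. \] Moreover, \[ \mu_{3}^{S}\leq\frac{3}{2^{2/3}}=1.889881574\dots \]
   Context: A collection of $3$ sets is a $3$-sunflower (a $\Delta$-system) if the intersection of any two of the three sets is the same set. A family of sets $\mathcal{F}$ is sunflower-free if no three distinct members of $\mathcal{F}$ form a $3$-sunflower. Let $F_3(n)$ denote the size of the largest sunflower-free collection of subsets of $\{1,2,\dots,n\}$, and define the Erdős–Szemerédi sunflower-free capacity $\mu_3^S=\limsup_{n\to\infty}F_3(n)^{1/n}$. -}

module Defs where

open import Data.Nat using (ℕ; suc; _+_; _*_; _^_; _≤_; _<_)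
open import Data.Nat.DivMod using (_/_)
open import Data.Nat.Combinatorics using (_C_)
open import Data.List using (List; map; upTo; length)
open import Data.Nat.ListAction using (sum)
open import Data.List.Membership.Propositional using (_∈_)
open import Data.List.Relation.Unary.Unique.Propositional using (Unique)
open import Data.Fin.Subset using (Subset; _∩_)
open import Data.Product using (_×_; ∃)
open import Relation.Binary.PropositionalEquality using (_≡_; _≢_)
open import Relation.Nullary using (¬_)

IsSunflower : ∀ {n} → Subset n → Subset n → Subset n → Set
IsSunflower A B C = (A ∩ B ≡ A ∩ C) × (A ∩ B ≡ B ∩ C)

-- A family (duplicate-free list of subsets of {1..n}, represented as Fin n)
-- is sunflower-free if no three distinct members form a sunflower.
SunflowerFree : ∀ {n} → List (Subset n) → Set
SunflowerFree {n} F = ∀ (A B C : Subset n) → A ∈ F → B ∈ F → C ∈ F →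
  A ≢ B → A ≢ C → B ≢ C → ¬ IsSunflower A B C

-- Σ_{0 ≤ k ≤ n/3} (n choose k);  k ≤ n/3 (real) iff k ≤ ⌊n/3⌋.
binomSumThird : ℕ → ℕ
binomSumThird n = sum (map (λ k → n C k) (upTo (suc (n / 3))))

Bound : Set
Bound = ∀ (n : ℕ) → 1 ≤ n → (F : List (Subset n)) → Unique F → SunflowerFree F →
  length F ≤ 3 * (n + 1) * binomSumThird n

-- Part 2: μ₃ˢ = limsup F₃(n)^{1/n} ≤ 3 / 2^{2/3}, stated as: for every rational
-- q = m/d with q > 3/2^{2/3} (i.e. 4 m³ > 27 d³), eventually every
-- sunflower-free family on [n] has size ≤ q^n.
MuBound : Set
MuBound = ∀ (m d : ℕ) → 0 < d → 27 * d ^ 3 < 4 * m ^ 3 →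
  ∃ λ N → ∀ (n : ℕ) → N ≤ n → (F : List (Subset n)) → Unique F → SunflowerFree F →
    length F * d ^ n ≤ m ^ n

-- Over 𝔽₃ the tensor T(x, y, z) = ∏ᵢ (1 + xᵢ + yᵢ + zᵢ) on subsets of [n] is
-- nonzero exactly when no i lies in exactly two of x, y, z, i.e. when x, y, z form a sunflower.
-- On the k-sets of a sunflower-free family T is therefore diagonal with nonzero diagonal, and by
-- the slice rank argument their number is at most the number of slices needed to write T.
-- Expanding the product, every monomial has degree ≤ n/3 in one of x, y, z, so
-- 3 ∑_{k ≤ n/3} (n choose k) slices suffice; summing over the n + 1 sizes k gives the first
-- bound. For the second, ∑_{k<t} (n choose k) 2^(n+1-t) ≤ 3^n yields
-- (∑_{k ≤ n/3} (n choose k))³ 4^n ≤ 27^n, and the remaining factor 27 (n + 1)³ is eventually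
-- absorbed by the gap between 27 d³ and 4 m³.

module Submission where

open import Defs
open import Algebra.Bundles using (CommutativeRing)
open import Algebra.Structures using (IsCommutativeRing)
import Algebra.Properties.CommutativeSemigroup as CommutativeSemigroup
open import Data.Bool.Base using (Bool; true; false; _∧_)
import Data.Bool.Properties as Bool
open import Data.Empty using (⊥-elim)
open import Data.Fin.Base using (Fin; zero; suc; punchIn; splitAt)
import Data.Fin.Properties as Fin
open import Data.Fin.Subset using (Subset; inside; outside; ∣_∣; _⊆_; _∩_)
open import Data.Fin.Subset.Properties
  using (p⊆q⇒∣p∣≤∣q∣; drop-∷-⊆; p∩q⊆q; ∩-idem; ∩-comm; ∣p∣≤n)
open import Data.List.Base using (List; []; _∷_; _++_; map; length; lookup; upTo; filter; [_])
import Data.List.Properties as List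
open import Data.List.Membership.Propositional using (_∈_)
open import Data.List.Membership.Propositional.Properties
  using (∈-map⁺; ∈-++⁺ˡ; ∈-++⁺ʳ; ∈-lookup; ∈-filter⁻)
open import Data.List.Relation.Unary.All as All using (All; []; _∷_)
open import Data.List.Relation.Unary.All.Properties using (all-filter)
open import Data.List.Relation.Unary.AllPairs using (_∷_)
open import Data.List.Relation.Unary.Any using (here; index)
open import Data.List.Relation.Unary.Any.Properties using (lookup-index)
open import Data.List.Relation.Unary.Unique.Propositional using (Unique)
import Data.List.Relation.Unary.Unique.Propositional.Properties as Unique
open import Data.Nat.Base as ℕ using (ℕ; zero; suc; _+_; _*_; _^_; _≤_; _<_; z≤n; s≤s; _/_; _%_; NonZero)
open import Data.Nat.Combinatorics using (_C_; nCk+nC[k+1]≡[n+1]C[k+1])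
open import Data.Nat.DivMod using (m≡m%n+[m/n]*n; m%n<n; m*n/n≡m; m/n*n≤m; /-monoˡ-≤)
open import Data.Nat.ListAction using (sum)
open import Data.Nat.ListAction.Properties using (sum-++)
import Data.Nat.Properties as ℕ
open import Data.Nat.Properties
  using (≤-trans; ≤-reflexive; +-mono-≤; *-mono-≤; *-monoˡ-≤; *-monoʳ-≤; ^-monoˡ-≤; ^-monoʳ-≤)
import Data.Nat.Tactic.RingSolver as ℕ
open import Data.Product using (∃; ∃-syntax; _×_; _,_; proj₁; proj₂)
open import Data.Sum.Base using (_⊎_; inj₁; inj₂)
open import Data.Vec.Base using (Vec; []; _∷_; here)
import Data.Vec.Base as Vec
open import Data.Vec.Functional using (Vector; tail) renaming (_∷_ to _∷ᵛ_; _++_ to _++ᵛ_)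
open import Data.Vec.Properties using (≡-dec)
open import Function.Base using (_∘_)
open import Level using (0ℓ)
open import Relation.Binary.Definitions using (DecidableEquality)
open import Relation.Binary.PropositionalEquality
  using (_≡_; _≢_; _≗_; refl; sym; trans; cong; cong₂; subst; isEquivalence; module ≡-Reasoning)
open import Relation.Nullary using (Dec; yes; no; does; ¬_)
open import Relation.Nullary.Decidable using (True; toWitness)
open import Relation.Nullary.Negation using (contradiction)
open import Relation.Unary using (Pred; Decidable)
open import Relation.Unary.Properties using (∁?)

open CommutativeSemigroup ℕ.+-commutativeSemigroup using () renaming (interchange to +-interchange)
open CommutativeSemigroup ℕ.*-commutativeSemigroup using () renaming (interchange to *-interchange)

data 𝔽₃ : Set where
  0# 1# 2# : 𝔽₃

infixl 6 _⊕_
infixl 7 _⊗_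
infix  8 ⊖_
infix  4 _≟_

_⊕_ : 𝔽₃ → 𝔽₃ → 𝔽₃
0# ⊕ b  = b
a  ⊕ 0# = a
1# ⊕ 1# = 2#
1# ⊕ 2# = 0#
2# ⊕ 1# = 0#
2# ⊕ 2# = 1#

_⊗_ : 𝔽₃ → 𝔽₃ → 𝔽₃
0# ⊗ b  = 0#
1# ⊗ b  = b
2# ⊗ 0# = 0#
2# ⊗ 1# = 2#
2# ⊗ 2# = 1#

⊖_ : 𝔽₃ → 𝔽₃
⊖ 0# = 0#
⊖ 1# = 2#
⊖ 2# = 1#

_≟_ : DecidableEquality 𝔽₃
0# ≟ 0# = yes refl
1# ≟ 1# = yes refl
2# ≟ 2# = yes refl
0# ≟ 1# = no λ ()
0# ≟ 2# = no λ ()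
1# ≟ 0# = no λ ()
1# ≟ 2# = no λ ()
2# ≟ 0# = no λ ()
2# ≟ 1# = no λ ()

all? : ∀ {p} {P : Pred 𝔽₃ p} → Decidable P → Dec (∀ a → P a)
all? P? with P? 0# | P? 1# | P? 2#
... | yes p₀ | yes p₁ | yes p₂ = yes λ { 0# → p₀ ; 1# → p₁ ; 2# → p₂ }
... | no ¬p₀ | _      | _      = no λ p → ¬p₀ (p 0#)
... | yes _  | no ¬p₁ | _      = no λ p → ¬p₁ (p 1#)
... | yes _  | yes _  | no ¬p₂ = no λ p → ¬p₂ (p 2#)

Op : ℕ → Set
Op zero    = 𝔽₃
Op (suc n) = 𝔽₃ → Op n

Pointwise : ∀ n → Op n → Op n → Set
Pointwise zero    a b = a ≡ b
Pointwise (suc n) f g = ∀ a → Pointwise n (f a) (g a)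

pointwise? : ∀ n (f g : Op n) → Dec (Pointwise n f g)
pointwise? zero    a b = a ≟ b
pointwise? (suc n) f g = all? λ a → pointwise? n (f a) (g a)

-- f and g are read off the expected type, so by-evaluation n proves an identity in n variables
-- by evaluating both sides at all 3ⁿ points.
by-evaluation : ∀ n {f g : Op n} {_ : True (pointwise? n f g)} → Pointwise n f g
by-evaluation n {_} {_} {equal} = toWitness equal

isCommutativeRing : IsCommutativeRing _≡_ _⊕_ _⊗_ ⊖_ 0# 1#
isCommutativeRing = record
  { isRing = record
    { +-isAbelianGroup = record
      { isGroup = record
        { isMonoid = record
          { isSemigroup = record
            { isMagma = record { isEquivalence = isEquivalence ; ∙-cong = cong₂ _⊕_ }
            ; assoc   = by-evaluation 3
            }
          ; identity = by-evaluation 1 , by-evaluation 1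
          }
        ; inverse = by-evaluation 1 , by-evaluation 1
        ; ⁻¹-cong = cong ⊖_
        }
      ; comm = by-evaluation 2
      }
    ; *-cong     = cong₂ _⊗_
    ; *-assoc    = by-evaluation 3
    ; *-identity = by-evaluation 1 , by-evaluation 1
    ; distrib    = by-evaluation 3 , by-evaluation 3
    }
  ; *-comm = by-evaluation 2
  }

commutativeRing : CommutativeRing 0ℓ 0ℓ
commutativeRing = record { isCommutativeRing = isCommutativeRing }

open CommutativeRing commutativeRing using (semiring; +-assoc; +-identityʳ; zeroʳ; distribˡ; *-assoc; *-comm)
open import Algebra.Properties.Semiring.Sum semiring
  using ( sum-syntax; sum-cong-≗; sum-replicate-zero; sum-remove
        ; ∑-distrib-+; ∑-comm; *-distribˡ-sum; *-distribʳ-sum)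

nonzero-square : ∀ {a} → a ≢ 0# → a ⊗ a ≡ 1#
nonzero-square {0#} a≢0 = ⊥-elim (a≢0 refl)
nonzero-square {1#} _   = refl
nonzero-square {2#} _   = refl

⊗-≢0ˡ : ∀ {a b} → a ⊗ b ≢ 0# → a ≢ 0#
⊗-≢0ˡ ab≢0 refl = ab≢0 refl

⊗-≢0ʳ : ∀ {a b} → a ⊗ b ≢ 0# → b ≢ 0#
⊗-≢0ʳ {a} ab≢0 refl = ab≢0 (zeroʳ a)

-- Vectors and matrices over 𝔽₃

∑-vanishes : ∀ {n} (f : Vector 𝔽₃ n) → (∀ i → f i ≡ 0#) → ∑[ i < n ] f i ≡ 0#
∑-vanishes {n} f f≡0 = trans (sum-cong-≗ f≡0) (sum-replicate-zero n)

∑-supported-at : ∀ {n} (f : Vector 𝔽₃ n) i → (∀ j → j ≢ i → f j ≡ 0#) → ∑[ j < n ] f j ≡ f i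
∑-supported-at {suc n} f i off = begin
  ∑[ j < suc n ] f j                ≡⟨ sum-remove {i = i} f ⟩
  f i ⊕ ∑[ j < n ] f (punchIn i j)  ≡⟨ cong (f i ⊕_) (∑-vanishes _ λ j → off _ (Fin.punchInᵢ≢i i j)) ⟩
  f i ⊕ 0#                          ≡⟨ +-identityʳ (f i) ⟩
  f i                               ∎
  where open ≡-Reasoning

∑-++ : ∀ {m n} (u : Vector 𝔽₃ m) (v : Vector 𝔽₃ n) →
       ∑[ i < m + n ] (u ++ᵛ v) i ≡ ∑[ i < m ] u i ⊕ ∑[ i < n ] v i
∑-++ {zero}      u v = refl
∑-++ {suc m} {n} u v = begin
  u zero ⊕ ∑[ i < m + n ] (u ++ᵛ v) (suc i)          ≡⟨ cong (u zero ⊕_) (sum-cong-≗ tail-++) ⟩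
  u zero ⊕ ∑[ i < m + n ] (tail u ++ᵛ v) i           ≡⟨ cong (u zero ⊕_) (∑-++ (tail u) v) ⟩
  u zero ⊕ (∑[ i < m ] u (suc i) ⊕ ∑[ i < n ] v i)  ≡⟨ +-assoc (u zero) _ _ ⟨
  ∑[ i < suc m ] u i ⊕ ∑[ i < n ] v i                ∎
  where
  open ≡-Reasoning
  tail-++ : ∀ i → (u ++ᵛ v) (suc i) ≡ (tail u ++ᵛ v) i
  tail-++ i with splitAt m i
  ... | inj₁ _ = refl
  ... | inj₂ _ = refl

⊗-++ : ∀ {m n} (u u′ : Vector 𝔽₃ m) (v v′ : Vector 𝔽₃ n) i →
       (u ++ᵛ v) i ⊗ (u′ ++ᵛ v′) i ≡ ((λ k → u k ⊗ u′ k) ++ᵛ (λ k → v k ⊗ v′ k)) i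
⊗-++ {m} u u′ v v′ i with splitAt m i
... | inj₁ _ = refl
... | inj₂ _ = refl

∑-⊗-⊕ : ∀ {n} (f g h : Vector 𝔽₃ n) →
        ∑[ i < n ] (f i ⊗ (g i ⊕ h i)) ≡ ∑[ i < n ] (f i ⊗ g i) ⊕ ∑[ i < n ] (f i ⊗ h i)
∑-⊗-⊕ f g h = trans (sum-cong-≗ λ i → distribˡ (f i) (g i) (h i)) (∑-distrib-+ (λ i → f i ⊗ g i) (λ i → f i ⊗ h i))

∑-⊗-0 : ∀ {n} (f : Vector 𝔽₃ n) → ∑[ i < n ] (f i ⊗ 0#) ≡ 0#
∑-⊗-0 f = ∑-vanishes _ λ i → zeroʳ (f i)

basis : ∀ {n} → Fin n → Vector 𝔽₃ n
basis i j with j Fin.≟ i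
... | yes _ = 1#
... | no  _ = 0#

∑-⊗-basis : ∀ {n} (f : Vector 𝔽₃ n) i a → ∑[ j < n ] (f j ⊗ (basis i j ⊗ a)) ≡ f i ⊗ a
∑-⊗-basis f i a =
  trans (∑-supported-at (λ j → f j ⊗ (basis i j ⊗ a)) i off) (cong (λ e → f i ⊗ (e ⊗ a)) basis-i)
  where
  off : ∀ j → j ≢ i → f j ⊗ (basis i j ⊗ a) ≡ 0#
  off j j≢i with j Fin.≟ i
  ... | yes j≡i = ⊥-elim (j≢i j≡i)
  ... | no  _   = zeroʳ (f j)
  basis-i : basis i i ≡ 1#
  basis-i with i Fin.≟ i
  ... | yes _   = refl
  ... | no  i≢i = ⊥-elim (i≢i refl)

∑-⊗-∑-comm : ∀ {n r} (v : Vector 𝔽₃ n) (a : Vector 𝔽₃ r) (b : Fin r → Fin n → 𝔽₃) →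
             ∑[ j < n ] (v j ⊗ ∑[ i < r ] (a i ⊗ b i j)) ≡ ∑[ i < r ] (a i ⊗ ∑[ j < n ] (v j ⊗ b i j))
∑-⊗-∑-comm {n} {r} v a b = begin
  ∑[ j < n ] (v j ⊗ ∑[ i < r ] (a i ⊗ b i j))
    ≡⟨ sum-cong-≗ (λ j → *-distribˡ-sum (v j) (λ i → a i ⊗ b i j)) ⟩
  ∑[ j < n ] ∑[ i < r ] (v j ⊗ (a i ⊗ b i j))
    ≡⟨ ∑-comm (λ j i → v j ⊗ (a i ⊗ b i j)) ⟩
  ∑[ i < r ] ∑[ j < n ] (v j ⊗ (a i ⊗ b i j))
    ≡⟨ sum-cong-≗ (λ i → sum-cong-≗ λ j → swap (v j) (a i) (b i j)) ⟩
  ∑[ i < r ] ∑[ j < n ] (a i ⊗ (v j ⊗ b i j))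
    ≡⟨ sum-cong-≗ (λ i → *-distribˡ-sum (a i) (λ j → v j ⊗ b i j)) ⟨
  ∑[ i < r ] (a i ⊗ ∑[ j < n ] (v j ⊗ b i j))
    ∎
  where
  open ≡-Reasoning
  swap : ∀ v a b → v ⊗ (a ⊗ b) ≡ a ⊗ (v ⊗ b)
  swap = by-evaluation 3

weight₁ : 𝔽₃ → ℕ
weight₁ 0# = 0
weight₁ _  = 1

weight : ∀ {n} → Vector 𝔽₃ n → ℕ
weight {zero}  v = 0
weight {suc n} v = weight₁ (v zero) + weight (tail v)

weight-cong : ∀ {n} {u v : Vector 𝔽₃ n} → u ≗ v → weight u ≡ weight v
weight-cong {zero}  u≗v = refl
weight-cong {suc n} u≗v = cong₂ _+_ (cong weight₁ (u≗v zero)) (weight-cong (u≗v ∘ suc))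

weight₁-disjoint : ∀ a b → a ⊗ b ≡ 0# → weight₁ a + weight₁ b ≤ 1
weight₁-disjoint 0# 0# _  = z≤n
weight₁-disjoint 0# 1# _  = s≤s z≤n
weight₁-disjoint 0# 2# _  = s≤s z≤n
weight₁-disjoint 1# 0# _  = s≤s z≤n
weight₁-disjoint 2# 0# _  = s≤s z≤n
weight₁-disjoint 1# 1# ()
weight₁-disjoint 1# 2# ()
weight₁-disjoint 2# 1# ()
weight₁-disjoint 2# 2# ()

weight-disjoint : ∀ {n} (u v : Vector 𝔽₃ n) → (∀ i → u i ⊗ v i ≡ 0#) → weight u + weight v ≤ n
weight-disjoint {zero}  u v _    = z≤n
weight-disjoint {suc n} u v uv≡0 = begin
  (a + weight (tail u)) + (b + weight (tail v))   ≡⟨ +-interchange a _ b _ ⟩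
  (a + b) + (weight (tail u) + weight (tail v))   ≤⟨ +-mono-≤ (weight₁-disjoint (u zero) (v zero) (uv≡0 zero))
                                                               (weight-disjoint (tail u) (tail v) (uv≡0 ∘ suc)) ⟩
  suc n                                           ∎
  where
  open ℕ.≤-Reasoning
  a b : ℕ
  a = weight₁ (u zero)
  b = weight₁ (v zero)

weight₁-scale : ∀ a {c} → c ≢ 0# → weight₁ (a ⊗ c) ≡ weight₁ a
weight₁-scale 0#      _   = refl
weight₁-scale 1# {0#} c≢0 = ⊥-elim (c≢0 refl)
weight₁-scale 1# {1#} _   = refl
weight₁-scale 1# {2#} _   = refl
weight₁-scale 2# {0#} c≢0 = ⊥-elim (c≢0 refl)
weight₁-scale 2# {1#} _   = refl
weight₁-scale 2# {2#} _   = refl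

weight-scale : ∀ {n} (v c : Vector 𝔽₃ n) → (∀ i → c i ≢ 0#) → weight (λ i → v i ⊗ c i) ≡ weight v
weight-scale {zero}  v c _   = refl
weight-scale {suc n} v c c≢0 =
  cong₂ _+_ (weight₁-scale (v zero) (c≢0 zero)) (weight-scale (tail v) (tail c) (c≢0 ∘ suc))

Matrix : ℕ → ℕ → Set
Matrix m n = Fin m → Fin n → 𝔽₃

_⊙_ : ∀ {l m n} → Matrix l m → Matrix m n → Matrix l n
_⊙_ {m = m} A B i k = ∑[ j < m ] (A i j ⊗ B j k)

LeftNull : ∀ {m n} → Matrix m n → Vector 𝔽₃ m → Set
LeftNull {m} A w = ∀ k → ∑[ j < m ] (w j ⊗ A j k) ≡ 0#

HeavyLeftNull : ∀ {m n} → Matrix m n → Set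
HeavyLeftNull {m} {n} A = ∃[ w ] LeftNull A w × m ≤ weight w + n

prepend-zero-row : ∀ {m n} (A : Matrix (suc m) n) → (∀ k → A zero k ≡ 0#) →
                   HeavyLeftNull (A ∘ suc) → HeavyLeftNull A
prepend-zero-row A row₀≡0 (w , w⊥A , m≤) =
  1# ∷ᵛ w , (λ k → cong₂ _⊕_ (cong (1# ⊗_) (row₀≡0 k)) (w⊥A k)) , s≤s m≤

-- Multiplying by the pivot c = A zero p divides by it, since c⁻¹ = c in 𝔽₃.
eliminate : ∀ {m n} → Matrix (suc m) (suc n) → Fin (suc n) → Matrix m n
eliminate A p j k = A (suc j) (punchIn p k) ⊕ ⊖ (A (suc j) p ⊗ (A zero p ⊗ A zero (punchIn p k)))

prepend-pivot-row : ∀ {m n} (A : Matrix (suc m) (suc n)) p → A zero p ≢ 0# →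
                    HeavyLeftNull (eliminate A p) → HeavyLeftNull A
prepend-pivot-row {m} {n} A p Ap≢0 (w , w⊥A′ , m≤) = w₀ ∷ᵛ w , w₀∷ᵛw⊥A , bound
  where
  c s w₀ : 𝔽₃
  c = A zero p
  s = ∑[ j < m ] (w j ⊗ A (suc j) p)
  w₀ = ⊖ (s ⊗ c)

  column-p : w₀ ⊗ c ⊕ s ≡ 0#
  column-p = begin
    ⊖ (s ⊗ c) ⊗ c ⊕ s       ≡⟨ factor s c ⟩
    s ⊗ (1# ⊕ ⊖ (c ⊗ c))    ≡⟨ cong (λ e → s ⊗ (1# ⊕ ⊖ e)) (nonzero-square Ap≢0) ⟩
    s ⊗ 0#                  ≡⟨ zeroʳ s ⟩
    0#                      ∎
    where
    open ≡-Reasoning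
    factor : ∀ s c → ⊖ (s ⊗ c) ⊗ c ⊕ s ≡ s ⊗ (1# ⊕ ⊖ (c ⊗ c))
    factor = by-evaluation 2

  column-punchIn : ∀ k → w₀ ⊗ A zero (punchIn p k) ⊕ ∑[ j < m ] (w j ⊗ A (suc j) (punchIn p k)) ≡ 0#
  column-punchIn k = begin
    w₀ ⊗ d ⊕ ∑[ j < m ] (w j ⊗ a j)
      ≡⟨ rearrange s c d _ ⟩
    ∑[ j < m ] (w j ⊗ a j) ⊕ s ⊗ ⊖ (c ⊗ d)
      ≡⟨ cong (∑[ j < m ] (w j ⊗ a j) ⊕_) (*-distribʳ-sum (⊖ (c ⊗ d)) (λ j → w j ⊗ b j)) ⟩
    ∑[ j < m ] (w j ⊗ a j) ⊕ ∑[ j < m ] (w j ⊗ b j ⊗ ⊖ (c ⊗ d))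
      ≡⟨ ∑-distrib-+ (λ j → w j ⊗ a j) _ ⟨
    ∑[ j < m ] (w j ⊗ a j ⊕ w j ⊗ b j ⊗ ⊖ (c ⊗ d))
      ≡⟨ sum-cong-≗ (λ j → expand (w j) (a j) (b j) (c ⊗ d)) ⟩
    ∑[ j < m ] (w j ⊗ eliminate A p j k)
      ≡⟨ w⊥A′ k ⟩
    0#
      ∎
    where
    open ≡-Reasoning
    a b : Vector 𝔽₃ m
    a j = A (suc j) (punchIn p k)
    b j = A (suc j) p
    d : 𝔽₃
    d = A zero (punchIn p k)
    rearrange : ∀ s c d x → ⊖ (s ⊗ c) ⊗ d ⊕ x ≡ x ⊕ s ⊗ ⊖ (c ⊗ d)
    rearrange = by-evaluation 4
    expand : ∀ w a b e → w ⊗ a ⊕ w ⊗ b ⊗ ⊖ e ≡ w ⊗ (a ⊕ ⊖ (b ⊗ e))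
    expand = by-evaluation 4

  w₀∷ᵛw⊥A : LeftNull A (w₀ ∷ᵛ w)
  w₀∷ᵛw⊥A k with k Fin.≟ p
  ... | yes refl = column-p
  ... | no  k≢p  = subst (λ k → w₀ ⊗ A zero k ⊕ ∑[ j < m ] (w j ⊗ A (suc j) k) ≡ 0#)
                         (Fin.punchIn-punchOut (k≢p ∘ sym)) (column-punchIn _)

  bound : suc m ≤ weight (w₀ ∷ᵛ w) + suc n
  bound = begin
    suc m                           ≤⟨ s≤s m≤ ⟩
    suc (weight w + n)              ≡⟨ ℕ.+-suc (weight w) n ⟨
    weight w + suc n                ≤⟨ ℕ.+-monoˡ-≤ (suc n) (ℕ.m≤n+m (weight w) (weight₁ w₀)) ⟩
    weight₁ w₀ + weight w + suc n   ∎
    where open ℕ.≤-Reasoning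

heavy-left-null-vector : ∀ {m n} (A : Matrix m n) → HeavyLeftNull A
heavy-left-null-vector {zero}          A = (λ ()) , (λ _ → refl) , z≤n
heavy-left-null-vector {suc m} {zero}  A = prepend-zero-row A (λ ()) (heavy-left-null-vector (A ∘ suc))
heavy-left-null-vector {suc m} {suc n} A with Fin.all? (λ k → A zero k ≟ 0#)
... | yes row₀≡0 = prepend-zero-row A row₀≡0 (heavy-left-null-vector (A ∘ suc))
... | no  row₀≢0 with Fin.¬∀⟶∃¬ _ _ (λ k → A zero k ≟ 0#) row₀≢0
...   | p , Ap≢0 = prepend-pivot-row A p Ap≢0 (heavy-left-null-vector (eliminate A p))

FactorsThrough : ∀ {m n} → ℕ → Matrix m n → Set
FactorsThrough {m} {n} r M = ∃ λ (A : Matrix m r) → ∃ λ (B : Matrix r n) →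
  ∀ i k → M i k ≡ (A ⊙ B) i k

-- A left null vector w of A is, through M = A ⊙ B, orthogonal to every row of M; when M is
-- diagonal this makes the supports of w and of the diagonal disjoint.
diagonal-weight≤ : ∀ {n r} (M : Matrix n n) → FactorsThrough r M → (∀ i k → i ≢ k → M i k ≡ 0#) →
                   weight (λ k → M k k) ≤ r
diagonal-weight≤ {n} {r} M (A , B , M≡A⊙B) off-diagonal with heavy-left-null-vector A
... | w , w⊥A , n≤ =
  ℕ.+-cancelˡ-≤ (weight w) _ _ (≤-trans (weight-disjoint w (λ k → M k k) w⊥diagonal) n≤)
  where
  w⊥diagonal : ∀ k → w k ⊗ M k k ≡ 0#
  w⊥diagonal k = begin
    w k ⊗ M k k
      ≡⟨ ∑-supported-at (λ i → w i ⊗ M i k) k off ⟨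
    ∑[ i < n ] (w i ⊗ M i k)
      ≡⟨ sum-cong-≗ (λ i → cong (w i ⊗_) (trans (M≡A⊙B i k) (sum-cong-≗ λ j → *-comm (A i j) (B j k)))) ⟩
    ∑[ i < n ] (w i ⊗ ∑[ j < r ] (B j k ⊗ A i j))
      ≡⟨ ∑-⊗-∑-comm w (λ j → B j k) (λ j i → A i j) ⟩
    ∑[ j < r ] (B j k ⊗ ∑[ i < n ] (w i ⊗ A i j))
      ≡⟨ ∑-vanishes _ (λ j → trans (cong (B j k ⊗_) (w⊥A j)) (zeroʳ (B j k))) ⟩
    0#
      ∎
    where
    open ≡-Reasoning
    off : ∀ i → i ≢ k → w i ⊗ M i k ≡ 0#
    off i i≢k = trans (cong (w i ⊗_) (off-diagonal i k i≢k)) (zeroʳ (w i))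

-- Slice rank

Tensor : Set → Set
Tensor X = X → X → X → 𝔽₃

Unary : ℕ → Set → Set
Unary r X = Fin r → X → 𝔽₃

Binary : ℕ → Set → Set
Binary r X = Fin r → X → X → 𝔽₃

_∔_ : ∀ {r X} → Binary r X → Binary r X → Binary r X
(g ∔ h) i u v = g i u v ⊕ h i u v

module Slices {X : Set} {r₁ r₂ r₃ : ℕ} (f₁ : Unary r₁ X) (f₂ : Unary r₂ X) (f₃ : Unary r₃ X) where

  slices₁ : Binary r₁ X → Tensor X
  slices₁ g x y z = ∑[ i < r₁ ] (f₁ i x ⊗ g i y z)

  slices₂ : Binary r₂ X → Tensor X
  slices₂ g x y z = ∑[ i < r₂ ] (f₂ i y ⊗ g i x z)

  slices₃ : Binary r₃ X → Tensor X
  slices₃ g x y z = ∑[ i < r₃ ] (f₃ i z ⊗ g i x y)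

  record SliceDecomposition (T : Tensor X) : Set where
    field
      g₁ : Binary r₁ X
      g₂ : Binary r₂ X
      g₃ : Binary r₃ X
      decomposes : ∀ x y z → T x y z ≡ slices₁ g₁ x y z ⊕ slices₂ g₂ x y z ⊕ slices₃ g₃ x y z

  ≗-decomposition : ∀ {T T′} → (∀ x y z → T x y z ≡ T′ x y z) → SliceDecomposition T → SliceDecomposition T′
  ≗-decomposition T≡T′ D = record
    { SliceDecomposition D
    ; decomposes = λ x y z → trans (sym (T≡T′ x y z)) (decomposes x y z)
    }
    where open SliceDecomposition D

  ⊕-decomposition : ∀ {T T′} → SliceDecomposition T → SliceDecomposition T′ →
                    SliceDecomposition (λ x y z → T x y z ⊕ T′ x y z)
  ⊕-decomposition {T} {T′} D D′ = record
    { g₁ = D.g₁ ∔ D′.g₁ ; g₂ = D.g₂ ∔ D′.g₂ ; g₃ = D.g₃ ∔ D′.g₃ ; decomposes = decomposes }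
    where
    module D = SliceDecomposition D
    module D′ = SliceDecomposition D′
    regroup : ∀ a b c a′ b′ c′ → (a ⊕ b ⊕ c) ⊕ (a′ ⊕ b′ ⊕ c′) ≡ (a ⊕ a′) ⊕ (b ⊕ b′) ⊕ (c ⊕ c′)
    regroup = by-evaluation 6
    decomposes : ∀ x y z → T x y z ⊕ T′ x y z ≡
                 slices₁ (D.g₁ ∔ D′.g₁) x y z ⊕ slices₂ (D.g₂ ∔ D′.g₂) x y z ⊕ slices₃ (D.g₃ ∔ D′.g₃) x y z
    decomposes x y z = begin
      T x y z ⊕ T′ x y z                     ≡⟨ cong₂ _⊕_ (D.decomposes x y z) (D′.decomposes x y z) ⟩
      (s₁ ⊕ s₂ ⊕ s₃) ⊕ (s₁′ ⊕ s₂′ ⊕ s₃′)    ≡⟨ regroup s₁ s₂ s₃ s₁′ s₂′ s₃′ ⟩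
      (s₁ ⊕ s₁′) ⊕ (s₂ ⊕ s₂′) ⊕ (s₃ ⊕ s₃′)  ≡⟨ cong₂ _⊕_ (cong₂ _⊕_ split₁ split₂) split₃ ⟨
      slices₁ (D.g₁ ∔ D′.g₁) x y z ⊕ slices₂ (D.g₂ ∔ D′.g₂) x y z ⊕ slices₃ (D.g₃ ∔ D′.g₃) x y z ∎
      where
      open ≡-Reasoning
      s₁ s₂ s₃ s₁′ s₂′ s₃′ : 𝔽₃
      s₁ = slices₁ D.g₁ x y z
      s₂ = slices₂ D.g₂ x y z
      s₃ = slices₃ D.g₃ x y z
      s₁′ = slices₁ D′.g₁ x y z
      s₂′ = slices₂ D′.g₂ x y z
      s₃′ = slices₃ D′.g₃ x y z
      split₁ : slices₁ (D.g₁ ∔ D′.g₁) x y z ≡ s₁ ⊕ s₁′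
      split₁ = ∑-⊗-⊕ (λ i → f₁ i x) (λ i → D.g₁ i y z) (λ i → D′.g₁ i y z)
      split₂ : slices₂ (D.g₂ ∔ D′.g₂) x y z ≡ s₂ ⊕ s₂′
      split₂ = ∑-⊗-⊕ (λ i → f₂ i y) (λ i → D.g₂ i x z) (λ i → D′.g₂ i x z)
      split₃ : slices₃ (D.g₃ ∔ D′.g₃) x y z ≡ s₃ ⊕ s₃′
      split₃ = ∑-⊗-⊕ (λ i → f₃ i z) (λ i → D.g₃ i x y) (λ i → D′.g₃ i x y)

  private
    0s : ∀ {r} → Binary r X
    0s _ _ _ = 0#

  slice₁-decomposition : ∀ i (g : X → X → 𝔽₃) → SliceDecomposition (λ x y z → f₁ i x ⊗ g y z)
  slice₁-decomposition i g = record
    { g₁ = λ j y z → basis i j ⊗ g y z ; g₂ = 0s ; g₃ = 0s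
    ; decomposes = λ x y z → sym (begin
        slices₁ (λ j y z → basis i j ⊗ g y z) x y z ⊕ slices₂ 0s x y z ⊕ slices₃ 0s x y z
          ≡⟨ cong₂ _⊕_ (cong₂ _⊕_ (∑-⊗-basis (λ j → f₁ j x) i (g y z)) (∑-⊗-0 (λ j → f₂ j y))) (∑-⊗-0 (λ j → f₃ j z)) ⟩
        f₁ i x ⊗ g y z ⊕ 0# ⊕ 0#
          ≡⟨ trans (+-identityʳ _) (+-identityʳ _) ⟩
        f₁ i x ⊗ g y z
          ∎)
    }
    where open ≡-Reasoning

  slice₂-decomposition : ∀ i (g : X → X → 𝔽₃) → SliceDecomposition (λ x y z → f₂ i y ⊗ g x z)
  slice₂-decomposition i g = record
    { g₁ = 0s ; g₂ = λ j x z → basis i j ⊗ g x z ; g₃ = 0s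
    ; decomposes = λ x y z → sym (begin
        slices₁ 0s x y z ⊕ slices₂ (λ j x z → basis i j ⊗ g x z) x y z ⊕ slices₃ 0s x y z
          ≡⟨ cong₂ _⊕_ (cong₂ _⊕_ (∑-⊗-0 (λ j → f₁ j x)) (∑-⊗-basis (λ j → f₂ j y) i (g x z))) (∑-⊗-0 (λ j → f₃ j z)) ⟩
        0# ⊕ f₂ i y ⊗ g x z ⊕ 0#
          ≡⟨ +-identityʳ _ ⟩
        f₂ i y ⊗ g x z
          ∎)
    }
    where open ≡-Reasoning

  slice₃-decomposition : ∀ i (g : X → X → 𝔽₃) → SliceDecomposition (λ x y z → f₃ i z ⊗ g x y)
  slice₃-decomposition i g = record
    { g₁ = 0s ; g₂ = 0s ; g₃ = λ j x y → basis i j ⊗ g x y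
    ; decomposes = λ x y z → sym
        (cong₂ _⊕_ (cong₂ _⊕_ (∑-⊗-0 (λ j → f₁ j x)) (∑-⊗-0 (λ j → f₂ j y))) (∑-⊗-basis (λ j → f₃ j z) i (g x y)))
    }

open Slices using (SliceDecomposition)

precompose : ∀ {X Y r₁ r₂ r₃} {f₁ : Unary r₁ X} {f₂ : Unary r₂ X} {f₃ : Unary r₃ X} {T : Tensor X} (a : Y → X) →
             SliceDecomposition f₁ f₂ f₃ T →
             SliceDecomposition (λ i → f₁ i ∘ a) (λ i → f₂ i ∘ a) (λ i → f₃ i ∘ a) (λ x y z → T (a x) (a y) (a z))
precompose a D = record
  { g₁ = λ i y z → g₁ i (a y) (a z)
  ; g₂ = λ i x z → g₂ i (a x) (a z)
  ; g₃ = λ i x y → g₃ i (a x) (a y)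
  ; decomposes = λ x y z → decomposes (a x) (a y) (a z)
  }
  where open SliceDecomposition D

contraction-factors : ∀ {N r₁ r₂ r₃} {f₁ : Unary r₁ (Fin N)} {f₂ : Unary r₂ (Fin N)} {f₃ : Unary r₃ (Fin N)}
                      {T : Tensor (Fin N)} → SliceDecomposition f₁ f₂ f₃ T → ∀ v → LeftNull (λ j i → f₃ i j) v →
                      FactorsThrough (r₁ + r₂) (λ l m → ∑[ j < N ] (v j ⊗ T l m j))
contraction-factors {N} {r₁} {r₂} {r₃} {f₁} {f₂} {f₃} {T} D v v⊥f₃ = A , B , M≡A⊙B
  where
  open SliceDecomposition D
  open Slices f₁ f₂ f₃ using (slices₁; slices₂; slices₃)

  P : Matrix r₁ N
  P i m = ∑[ j < N ] (v j ⊗ g₁ i m j)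

  Q : Matrix r₂ N
  Q i l = ∑[ j < N ] (v j ⊗ g₂ i l j)

  A : Matrix N (r₁ + r₂)
  A l = (λ i → f₁ i l) ++ᵛ (λ i → Q i l)

  B : Matrix (r₁ + r₂) N
  B i m = ((λ i → P i m) ++ᵛ (λ i → f₂ i m)) i

  M≡A⊙B : ∀ l m → ∑[ j < N ] (v j ⊗ T l m j) ≡ (A ⊙ B) l m
  M≡A⊙B l m = begin
    ∑[ j < N ] (v j ⊗ T l m j)
      ≡⟨ sum-cong-≗ (λ j → cong (v j ⊗_) (decomposes l m j)) ⟩
    ∑[ j < N ] (v j ⊗ (slices₁ g₁ l m j ⊕ slices₂ g₂ l m j ⊕ slices₃ g₃ l m j))
      ≡⟨ ∑-⊗-⊕ v _ _ ⟩
    ∑[ j < N ] (v j ⊗ (slices₁ g₁ l m j ⊕ slices₂ g₂ l m j)) ⊕ ∑[ j < N ] (v j ⊗ slices₃ g₃ l m j)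
      ≡⟨ cong₂ _⊕_ (∑-⊗-⊕ v _ _) third-vanishes ⟩
    ∑[ j < N ] (v j ⊗ slices₁ g₁ l m j) ⊕ ∑[ j < N ] (v j ⊗ slices₂ g₂ l m j) ⊕ 0#
      ≡⟨ +-identityʳ _ ⟩
    ∑[ j < N ] (v j ⊗ slices₁ g₁ l m j) ⊕ ∑[ j < N ] (v j ⊗ slices₂ g₂ l m j)
      ≡⟨ cong₂ _⊕_ (∑-⊗-∑-comm v (λ i → f₁ i l) (λ i j → g₁ i m j)) second ⟩
    ∑[ i < r₁ ] (f₁ i l ⊗ P i m) ⊕ ∑[ i < r₂ ] (Q i l ⊗ f₂ i m)
      ≡⟨ ∑-++ (λ i → f₁ i l ⊗ P i m) (λ i → Q i l ⊗ f₂ i m) ⟨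
    ∑[ i < r₁ + r₂ ] ((λ i → f₁ i l ⊗ P i m) ++ᵛ (λ i → Q i l ⊗ f₂ i m)) i
      ≡⟨ sum-cong-≗ (⊗-++ (λ i → f₁ i l) (λ i → P i m) (λ i → Q i l) (λ i → f₂ i m)) ⟨
    (A ⊙ B) l m
      ∎
    where
    open ≡-Reasoning
    second : ∑[ j < N ] (v j ⊗ slices₂ g₂ l m j) ≡ ∑[ i < r₂ ] (Q i l ⊗ f₂ i m)
    second = trans (∑-⊗-∑-comm v (λ i → f₂ i m) (λ i j → g₂ i l j)) (sum-cong-≗ λ i → *-comm (f₂ i m) (Q i l))
    third-vanishes : ∑[ j < N ] (v j ⊗ slices₃ g₃ l m j) ≡ 0#
    third-vanishes = begin
      ∑[ j < N ] (v j ⊗ slices₃ g₃ l m j)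
        ≡⟨ sum-cong-≗ (λ j → cong (v j ⊗_) (sum-cong-≗ λ i → *-comm (f₃ i j) (g₃ i l m))) ⟩
      ∑[ j < N ] (v j ⊗ ∑[ i < r₃ ] (g₃ i l m ⊗ f₃ i j))
        ≡⟨ ∑-⊗-∑-comm v (λ i → g₃ i l m) f₃ ⟩
      ∑[ i < r₃ ] (g₃ i l m ⊗ ∑[ j < N ] (v j ⊗ f₃ i j))
        ≡⟨ ∑-vanishes _ (λ i → trans (cong (g₃ i l m ⊗_) (v⊥f₃ i)) (zeroʳ _)) ⟩
      0#
        ∎

IsDiagonal : ∀ {N} → Tensor (Fin N) → Set
IsDiagonal T = ∀ l m j → T l m j ≢ 0# → l ≡ m × m ≡ j

-- Contracting T along a heavy v ⊥ f₃ leaves a diagonal matrix with the support of v on its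
-- diagonal, which factors through 𝔽₃^(r₁ + r₂).
diagonal-slice-rank : ∀ {N r₁ r₂ r₃} {f₁ : Unary r₁ (Fin N)} {f₂ : Unary r₂ (Fin N)} {f₃ : Unary r₃ (Fin N)}
                      {T : Tensor (Fin N)} → SliceDecomposition f₁ f₂ f₃ T →
                      IsDiagonal T → (∀ m → T m m m ≢ 0#) → N ≤ r₁ + r₂ + r₃
diagonal-slice-rank {N} {r₁} {r₂} {r₃} {f₃ = f₃} {T} D diagonal T≢0
  with heavy-left-null-vector (λ j i → f₃ i j)
... | v , v⊥f₃ , N≤ = ≤-trans N≤ (ℕ.+-monoˡ-≤ r₃ (begin
  weight v                      ≡⟨ weight-scale v (λ m → T m m m) T≢0 ⟨
  weight (λ m → v m ⊗ T m m m)  ≡⟨ weight-cong M-diagonal ⟨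
  weight (λ m → M m m)          ≤⟨ diagonal-weight≤ M (contraction-factors D v v⊥f₃) M-off ⟩
  r₁ + r₂                       ∎))
  where
  open ℕ.≤-Reasoning
  M : Matrix N N
  M l m = ∑[ j < N ] (v j ⊗ T l m j)

  T-off : ∀ l m j → ¬ (l ≡ m × m ≡ j) → T l m j ≡ 0#
  T-off l m j ¬diagonal with T l m j ≟ 0#
  ... | yes T≡0 = T≡0
  ... | no  T≢0 = contradiction (diagonal l m j T≢0) ¬diagonal

  M-off : ∀ l m → l ≢ m → M l m ≡ 0#
  M-off l m l≢m = ∑-vanishes _ λ j → trans (cong (v j ⊗_) (T-off l m j (l≢m ∘ proj₁))) (zeroʳ (v j))

  M-diagonal : ∀ m → M m m ≡ v m ⊗ T m m m
  M-diagonal m = ∑-supported-at _ m λ j j≢m →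
    trans (cong (v j ⊗_) (T-off m m j λ (_ , m≡j) → j≢m (sym m≡j))) (zeroʳ (v j))

-- Binomial sums

partialRowSum : ℕ → ℕ → ℕ
partialRowSum n t = sum (map (n C_) (upTo t))

partialRowSum-suc : ∀ n t → partialRowSum n (suc t) ≡ partialRowSum n t + n C t
partialRowSum-suc n t = begin
  sum (map (n C_) (upTo (suc t)))         ≡⟨ cong (sum ∘ map (n C_)) (List.upTo-∷ʳ t) ⟨
  sum (map (n C_) (upTo t ++ [ t ]))      ≡⟨ cong sum (List.map-++ (n C_) (upTo t) [ t ]) ⟩
  sum (map (n C_) (upTo t) ++ [ n C t ])  ≡⟨ sum-++ (map (n C_) (upTo t)) [ n C t ] ⟩
  partialRowSum n t + (n C t + 0)         ≡⟨ cong (partialRowSum n t +_) (ℕ.+-identityʳ (n C t)) ⟩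
  partialRowSum n t + n C t               ∎
  where open ≡-Reasoning

partialRowSum-pascal : ∀ n t → partialRowSum (suc n) (suc t) ≡ partialRowSum n t + partialRowSum n (suc t)
partialRowSum-pascal n zero    = refl
partialRowSum-pascal n (suc t) = begin
  partialRowSum (suc n) (suc (suc t))
    ≡⟨ partialRowSum-suc (suc n) (suc t) ⟩
  partialRowSum (suc n) (suc t) + suc n C suc t
    ≡⟨ cong₂ _+_ (partialRowSum-pascal n t) (sym (nCk+nC[k+1]≡[n+1]C[k+1] n t)) ⟩
  (partialRowSum n t + partialRowSum n (suc t)) + (n C t + n C suc t)
    ≡⟨ +-interchange (partialRowSum n t) _ (n C t) _ ⟩
  (partialRowSum n t + n C t) + (partialRowSum n (suc t) + n C suc t)
    ≡⟨ cong₂ _+_ (partialRowSum-suc n t) (partialRowSum-suc n (suc t)) ⟨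
  partialRowSum n (suc t) + partialRowSum n (suc (suc t))
    ∎
  where open ≡-Reasoning

partialRowSum-0 : ∀ t → partialRowSum 0 (suc t) ≡ 1
partialRowSum-0 zero    = refl
partialRowSum-0 (suc t) = trans (partialRowSum-suc 0 (suc t)) (cong (_+ 0) (partialRowSum-0 t))

subsetsBelow : ∀ n → ℕ → List (Subset n)
subsetsBelow n       zero    = []
subsetsBelow zero    (suc t) = [ [] ]
subsetsBelow (suc n) (suc t) = map (inside ∷_) (subsetsBelow n t) ++ map (outside ∷_) (subsetsBelow n (suc t))

length-subsetsBelow : ∀ n t → length (subsetsBelow n t) ≡ partialRowSum n t
length-subsetsBelow n       zero    = refl
length-subsetsBelow zero    (suc t) = sym (partialRowSum-0 t)
length-subsetsBelow (suc n) (suc t) = begin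
  length (map (inside ∷_) (subsetsBelow n t) ++ map (outside ∷_) (subsetsBelow n (suc t)))
    ≡⟨ List.length-++ (map (inside ∷_) (subsetsBelow n t)) ⟩
  length (map (inside ∷_) (subsetsBelow n t)) + length (map (outside ∷_) (subsetsBelow n (suc t)))
    ≡⟨ cong₂ _+_ (List.length-map (inside ∷_) (subsetsBelow n t))
                 (List.length-map (outside ∷_) (subsetsBelow n (suc t))) ⟩
  length (subsetsBelow n t) + length (subsetsBelow n (suc t))
    ≡⟨ cong₂ _+_ (length-subsetsBelow n t) (length-subsetsBelow n (suc t)) ⟩
  partialRowSum n t + partialRowSum n (suc t)
    ≡⟨ partialRowSum-pascal n t ⟨
  partialRowSum (suc n) (suc t)
    ∎
  where open ≡-Reasoning

∈-subsetsBelow : ∀ {n t} (α : Subset n) → ∣ α ∣ < t → α ∈ subsetsBelow n t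
∈-subsetsBelow {zero}  {suc t} []            _           = here refl
∈-subsetsBelow {suc n} {suc t} (inside  ∷ α) (s≤s |α|<t) =
  ∈-++⁺ˡ (∈-map⁺ (inside ∷_) (∈-subsetsBelow α |α|<t))
∈-subsetsBelow {suc n} {suc t} (outside ∷ α) |α|<1+t     =
  ∈-++⁺ʳ (map (inside ∷_) (subsetsBelow n t)) (∈-map⁺ (outside ∷_) (∈-subsetsBelow α |α|<1+t))

-- The sunflower tensor

⟦_⟧ : Bool → 𝔽₃
⟦ true  ⟧ = 1#
⟦ false ⟧ = 0#

sunflowerTensor : ∀ {n} → Tensor (Subset n)
sunflowerTensor []      []      []      = 1#
sunflowerTensor (a ∷ x) (b ∷ y) (c ∷ z) = (⟦ a ⟧ ⊕ ⟦ b ⟧ ⊕ ⟦ c ⟧ ⊕ 1#) ⊗ sunflowerTensor x y z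

coordinate-sunflower : ∀ a b c → ⟦ a ⟧ ⊕ ⟦ b ⟧ ⊕ ⟦ c ⟧ ⊕ 1# ≢ 0# → a ∧ b ≡ a ∧ c × a ∧ b ≡ b ∧ c
coordinate-sunflower true  true  true  _ = refl , refl
coordinate-sunflower true  true  false h = contradiction refl h
coordinate-sunflower true  false true  h = contradiction refl h
coordinate-sunflower true  false false _ = refl , refl
coordinate-sunflower false true  true  h = contradiction refl h
coordinate-sunflower false true  false _ = refl , refl
coordinate-sunflower false false true  _ = refl , refl
coordinate-sunflower false false false _ = refl , refl

sunflowerTensor≢0⇒sunflower : ∀ {n} (x y z : Subset n) → sunflowerTensor x y z ≢ 0# → IsSunflower x y z
sunflowerTensor≢0⇒sunflower []      []      []      _   = refl , refl
sunflowerTensor≢0⇒sunflower (a ∷ x) (b ∷ y) (c ∷ z) T≢0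
  with coordinate-sunflower a b c (⊗-≢0ˡ T≢0) | sunflowerTensor≢0⇒sunflower x y z (⊗-≢0ʳ T≢0)
... | head₁ , head₂ | tail₁ , tail₂ = cong₂ _∷_ head₁ tail₁ , cong₂ _∷_ head₂ tail₂

sunflowerTensor-diagonal : ∀ {n} (x : Subset n) → sunflowerTensor x x x ≡ 1#
sunflowerTensor-diagonal []          = refl
sunflowerTensor-diagonal (true  ∷ x) = sunflowerTensor-diagonal x
sunflowerTensor-diagonal (false ∷ x) = sunflowerTensor-diagonal x

monomial : ∀ {n} → Subset n → Subset n → 𝔽₃
monomial []            []      = 1#
monomial (inside  ∷ α) (a ∷ x) = ⟦ a ⟧ ⊗ monomial α x
monomial (outside ∷ α) (_ ∷ x) = monomial α x

-- A word σ chooses one of the four summands xᵢ, yᵢ, zᵢ, 1 in every factor of the sunflower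
-- tensor; wordMonomial σ is the product of the chosen summands.
data Pick : Set where
  pickX pickY pickZ pick1 : Pick

pickValue : Pick → Bool → Bool → Bool → 𝔽₃
pickValue pickX a _ _ = ⟦ a ⟧
pickValue pickY _ b _ = ⟦ b ⟧
pickValue pickZ _ _ c = ⟦ c ⟧
pickValue pick1 _ _ _ = 1#

xPositions yPositions zPositions : ∀ {n} → Vec Pick n → Subset n
xPositions = Vec.map λ { pickX → inside ; _ → outside }
yPositions = Vec.map λ { pickY → inside ; _ → outside }
zPositions = Vec.map λ { pickZ → inside ; _ → outside }

wordMonomial : ∀ {n} → Vec Pick n → Tensor (Subset n)
wordMonomial σ x y z = monomial (xPositions σ) x ⊗ monomial (yPositions σ) y ⊗ monomial (zPositions σ) z

wordMonomial-∷ : ∀ {n} p (σ : Vec Pick n) a b c x y z →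
                 wordMonomial (p ∷ σ) (a ∷ x) (b ∷ y) (c ∷ z) ≡ pickValue p a b c ⊗ wordMonomial σ x y z
wordMonomial-∷ p σ a b c x y z = by-pick p
  where
  u v w : 𝔽₃
  u = monomial (xPositions σ) x
  v = monomial (yPositions σ) y
  w = monomial (zPositions σ) z
  moveˣ : ∀ a u v w → a ⊗ u ⊗ v ⊗ w ≡ a ⊗ (u ⊗ v ⊗ w)
  moveˣ = by-evaluation 4
  moveʸ : ∀ b u v w → u ⊗ (b ⊗ v) ⊗ w ≡ b ⊗ (u ⊗ v ⊗ w)
  moveʸ = by-evaluation 4
  moveᶻ : ∀ c u v w → u ⊗ v ⊗ (c ⊗ w) ≡ c ⊗ (u ⊗ v ⊗ w)
  moveᶻ = by-evaluation 4
  by-pick : ∀ p → wordMonomial (p ∷ σ) (a ∷ x) (b ∷ y) (c ∷ z) ≡ pickValue p a b c ⊗ (u ⊗ v ⊗ w)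
  by-pick pickX = moveˣ ⟦ a ⟧ u v w
  by-pick pickY = moveʸ ⟦ b ⟧ u v w
  by-pick pickZ = moveᶻ ⟦ c ⟧ u v w
  by-pick pick1 = refl

∑ʷ : ∀ n → (Vec Pick n → 𝔽₃) → 𝔽₃
∑ʷ zero    φ = φ []
∑ʷ (suc n) φ =
  ∑ʷ n (φ ∘ (pickX ∷_)) ⊕ ∑ʷ n (φ ∘ (pickY ∷_)) ⊕ ∑ʷ n (φ ∘ (pickZ ∷_)) ⊕ ∑ʷ n (φ ∘ (pick1 ∷_))

∑ʷ-cong : ∀ n {φ ψ : Vec Pick n → 𝔽₃} → φ ≗ ψ → ∑ʷ n φ ≡ ∑ʷ n ψ
∑ʷ-cong zero    φ≗ψ = φ≗ψ []
∑ʷ-cong (suc n) {φ} {ψ} φ≗ψ =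
  cong₂ _⊕_ (cong₂ _⊕_ (cong₂ _⊕_ (after pickX) (after pickY)) (after pickZ)) (after pick1)
  where
  after : ∀ p → ∑ʷ n (φ ∘ (p ∷_)) ≡ ∑ʷ n (ψ ∘ (p ∷_))
  after p = ∑ʷ-cong n (φ≗ψ ∘ (p ∷_))

∑ʷ-⊗ : ∀ n c (φ : Vec Pick n → 𝔽₃) → ∑ʷ n (λ σ → c ⊗ φ σ) ≡ c ⊗ ∑ʷ n φ
∑ʷ-⊗ zero    c φ = refl
∑ʷ-⊗ (suc n) c φ = trans
  (cong₂ _⊕_ (cong₂ _⊕_ (cong₂ _⊕_ (after pickX) (after pickY)) (after pickZ)) (after pick1))
  (factor c _ _ _ _)
  where
  after : ∀ p → ∑ʷ n (λ σ → c ⊗ φ (p ∷ σ)) ≡ c ⊗ ∑ʷ n (φ ∘ (p ∷_))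
  after p = ∑ʷ-⊗ n c (φ ∘ (p ∷_))
  factor : ∀ c a b d e → c ⊗ a ⊕ c ⊗ b ⊕ c ⊗ d ⊕ c ⊗ e ≡ c ⊗ (a ⊕ b ⊕ d ⊕ e)
  factor = by-evaluation 5

sunflowerTensor-expansion : ∀ {n} (x y z : Subset n) →
                            sunflowerTensor x y z ≡ ∑ʷ n (λ σ → wordMonomial σ x y z)
sunflowerTensor-expansion []      []      []      = refl
sunflowerTensor-expansion {suc n} (a ∷ x) (b ∷ y) (c ∷ z) = begin
  (⟦ a ⟧ ⊕ ⟦ b ⟧ ⊕ ⟦ c ⟧ ⊕ 1#) ⊗ sunflowerTensor x y z
    ≡⟨ cong ((⟦ a ⟧ ⊕ ⟦ b ⟧ ⊕ ⟦ c ⟧ ⊕ 1#) ⊗_) (sunflowerTensor-expansion x y z) ⟩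
  (⟦ a ⟧ ⊕ ⟦ b ⟧ ⊕ ⟦ c ⟧ ⊕ 1#) ⊗ E
    ≡⟨ distribute ⟦ a ⟧ ⟦ b ⟧ ⟦ c ⟧ E ⟩
  ⟦ a ⟧ ⊗ E ⊕ ⟦ b ⟧ ⊗ E ⊕ ⟦ c ⟧ ⊗ E ⊕ 1# ⊗ E
    ≡⟨ cong₂ _⊕_ (cong₂ _⊕_ (cong₂ _⊕_ (picked pickX) (picked pickY)) (picked pickZ)) (picked pick1) ⟩
  ∑ʷ (suc n) (λ σ → wordMonomial σ (a ∷ x) (b ∷ y) (c ∷ z))
    ∎
  where
  open ≡-Reasoning
  E : 𝔽₃
  E = ∑ʷ n (λ σ → wordMonomial σ x y z)
  distribute : ∀ a b c e → (a ⊕ b ⊕ c ⊕ 1#) ⊗ e ≡ a ⊗ e ⊕ b ⊗ e ⊕ c ⊗ e ⊕ 1# ⊗ e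
  distribute = by-evaluation 4
  picked : ∀ p → pickValue p a b c ⊗ E ≡ ∑ʷ n (λ σ → wordMonomial (p ∷ σ) (a ∷ x) (b ∷ y) (c ∷ z))
  picked p = sym (trans (∑ʷ-cong n λ σ → wordMonomial-∷ p σ a b c x y z) (∑ʷ-⊗ n _ _))

∑ʷ-decomposition : ∀ {X r₁ r₂ r₃} {f₁ : Unary r₁ X} {f₂ : Unary r₂ X} {f₃ : Unary r₃ X}
                   n (φ : Vec Pick n → Tensor X) → (∀ σ → SliceDecomposition f₁ f₂ f₃ (φ σ)) →
                   SliceDecomposition f₁ f₂ f₃ (λ x y z → ∑ʷ n (λ σ → φ σ x y z))
∑ʷ-decomposition                      zero    φ D = D []
∑ʷ-decomposition {f₁ = f₁} {f₂} {f₃} (suc n) φ D =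
  ⊕-decomposition (⊕-decomposition (⊕-decomposition (after pickX) (after pickY)) (after pickZ)) (after pick1)
  where
  open Slices f₁ f₂ f₃ using (⊕-decomposition)
  after : ∀ p → SliceDecomposition f₁ f₂ f₃ (λ x y z → ∑ʷ n (λ σ → φ (p ∷ σ) x y z))
  after p = ∑ʷ-decomposition n (φ ∘ (p ∷_)) (D ∘ (p ∷_))

positions-size : ∀ {n} (σ : Vec Pick n) → ∣ xPositions σ ∣ + ∣ yPositions σ ∣ + ∣ zPositions σ ∣ ≤ n
positions-size []          = z≤n
positions-size (pickX ∷ σ) = s≤s (positions-size σ)
positions-size (pickY ∷ σ) =
  ≤-trans (≤-reflexive (cong (_+ ∣ zPositions σ ∣) (ℕ.+-suc _ _))) (s≤s (positions-size σ))
positions-size (pickZ ∷ σ) = ≤-trans (≤-reflexive (ℕ.+-suc _ _)) (s≤s (positions-size σ))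
positions-size (pick1 ∷ σ) = ℕ.m≤n⇒m≤1+n (positions-size σ)

one-third-small : ∀ a b c {n} → a + b + c ≤ n → a ≤ n / 3 ⊎ b ≤ n / 3 ⊎ c ≤ n / 3
one-third-small a b c {n} a+b+c≤n with a ℕ.≤? n / 3 | b ℕ.≤? n / 3 | c ℕ.≤? n / 3
... | yes a≤ | _      | _      = inj₁ a≤
... | no  _  | yes b≤ | _      = inj₂ (inj₁ b≤)
... | no  _  | no  _  | yes c≤ = inj₂ (inj₂ c≤)
... | no  a> | no  b> | no  c> = contradiction a+b+c≤n (ℕ.<⇒≱ n<a+b+c)
  where
  q : ℕ
  q = n / 3
  thrice : ∀ q → 3 + q * 3 ≡ suc q + suc q + suc q
  thrice = ℕ.solve-∀
  n<a+b+c : n < a + b + c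
  n<a+b+c = begin-strict
    n                          ≡⟨ m≡m%n+[m/n]*n n 3 ⟩
    n % 3 + q * 3              <⟨ ℕ.+-monoˡ-< (q * 3) (m%n<n n 3) ⟩
    3 + q * 3                  ≡⟨ thrice q ⟩
    suc q + suc q + suc q      ≤⟨ +-mono-≤ (+-mono-≤ (ℕ.≰⇒> a>) (ℕ.≰⇒> b>)) (ℕ.≰⇒> c>) ⟩
    a + b + c                  ∎
    where open ℕ.≤-Reasoning

smallSubsets : ∀ n → List (Subset n)
smallSubsets n = subsetsBelow n (suc (n / 3))

smallMonomial : ∀ n → Fin (length (smallSubsets n)) → Subset n → 𝔽₃
smallMonomial n i = monomial (lookup (smallSubsets n) i)

smallSubset-index : ∀ {n} (α : Subset n) → ∣ α ∣ ≤ n / 3 → ∃[ i ] lookup (smallSubsets n) i ≡ α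
smallSubset-index {n} α small = index α∈ , sym (lookup-index α∈)
  where
  α∈ : α ∈ smallSubsets n
  α∈ = ∈-subsetsBelow α (s≤s small)

SmallDegreeDecomposition : ∀ n → Tensor (Subset n) → Set
SmallDegreeDecomposition n = SliceDecomposition (smallMonomial n) (smallMonomial n) (smallMonomial n)

wordMonomial-decomposition : ∀ {n} (σ : Vec Pick n) → SmallDegreeDecomposition n (wordMonomial σ)
wordMonomial-decomposition {n} σ =
  by-small-factor (one-third-small (∣ xPositions σ ∣) (∣ yPositions σ ∣) (∣ zPositions σ ∣) (positions-size σ))
  where
  open Slices (smallMonomial n) (smallMonomial n) (smallMonomial n)
    using (≗-decomposition; slice₁-decomposition; slice₂-decomposition; slice₃-decomposition)
  mˣ mʸ mᶻ : Subset n → 𝔽₃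
  mˣ = monomial (xPositions σ)
  mʸ = monomial (yPositions σ)
  mᶻ = monomial (zPositions σ)
  move : ∀ u v w → v ⊗ (u ⊗ w) ≡ u ⊗ v ⊗ w
  move = by-evaluation 3
  by-small-factor : ∣ xPositions σ ∣ ≤ n / 3 ⊎ ∣ yPositions σ ∣ ≤ n / 3 ⊎ ∣ zPositions σ ∣ ≤ n / 3 →
                    SmallDegreeDecomposition n (wordMonomial σ)
  by-small-factor (inj₁ x-small) with smallSubset-index (xPositions σ) x-small
  ... | i , i↦x = ≗-decomposition
    (λ x y z → trans (cong (λ α → monomial α x ⊗ (mʸ y ⊗ mᶻ z)) i↦x) (sym (*-assoc (mˣ x) (mʸ y) (mᶻ z))))
    (slice₁-decomposition i λ y z → mʸ y ⊗ mᶻ z)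
  by-small-factor (inj₂ (inj₁ y-small)) with smallSubset-index (yPositions σ) y-small
  ... | i , i↦y = ≗-decomposition
    (λ x y z → trans (cong (λ α → monomial α y ⊗ (mˣ x ⊗ mᶻ z)) i↦y) (move (mˣ x) (mʸ y) (mᶻ z)))
    (slice₂-decomposition i λ x z → mˣ x ⊗ mᶻ z)
  by-small-factor (inj₂ (inj₂ z-small)) with smallSubset-index (zPositions σ) z-small
  ... | i , i↦z = ≗-decomposition
    (λ x y z → trans (cong (λ α → monomial α z ⊗ (mˣ x ⊗ mʸ y)) i↦z) (*-comm (mᶻ z) (mˣ x ⊗ mʸ y)))
    (slice₃-decomposition i λ x y → mˣ x ⊗ mʸ y)

sunflowerTensor-decomposition : ∀ n → SmallDegreeDecomposition n sunflowerTensor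
sunflowerTensor-decomposition n =
  Slices.≗-decomposition _ _ _ (λ x y z → sym (sunflowerTensor-expansion x y z))
                                (∑ʷ-decomposition n wordMonomial wordMonomial-decomposition)

-- Sunflower-free families

⊆∧∣∣≡⇒≡ : ∀ {n} {p q : Subset n} → p ⊆ q → ∣ p ∣ ≡ ∣ q ∣ → p ≡ q
⊆∧∣∣≡⇒≡ {p = []}          {[]}          _   _  = refl
⊆∧∣∣≡⇒≡ {p = inside  ∷ p} {inside  ∷ q} p⊆q eq =
  cong (inside ∷_) (⊆∧∣∣≡⇒≡ (drop-∷-⊆ p⊆q) (ℕ.suc-injective eq))
⊆∧∣∣≡⇒≡ {p = inside  ∷ p} {outside ∷ q} p⊆q _  = contradiction (p⊆q here) λ ()
⊆∧∣∣≡⇒≡ {p = outside ∷ p} {inside  ∷ q} p⊆q eq =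
  contradiction eq (ℕ.<⇒≢ (s≤s (p⊆q⇒∣p∣≤∣q∣ (drop-∷-⊆ p⊆q))))
⊆∧∣∣≡⇒≡ {p = outside ∷ p} {outside ∷ q} p⊆q eq = cong (outside ∷_) (⊆∧∣∣≡⇒≡ (drop-∷-⊆ p⊆q) eq)

p∩q≡p⇒p⊆q : ∀ {n} {p q : Subset n} → p ∩ q ≡ p → p ⊆ q
p∩q≡p⇒p⊆q {p = p} {q} eq = subst (_⊆ q) eq (p∩q⊆q p q)

uniform-⊆⇒≡ : ∀ {n k} {F : List (Subset n)} → All (λ x → ∣ x ∣ ≡ k) F →
              ∀ {x y} → x ∈ F → y ∈ F → x ⊆ y → x ≡ y
uniform-⊆⇒≡ uniform x∈F y∈F x⊆y =
  ⊆∧∣∣≡⇒≡ x⊆y (trans (All.lookup uniform x∈F) (sym (All.lookup uniform y∈F)))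

sunflower-trivial : ∀ {n k} {F : List (Subset n)} → SunflowerFree F → All (λ x → ∣ x ∣ ≡ k) F →
                    ∀ {x y z} → x ∈ F → y ∈ F → z ∈ F → IsSunflower x y z → x ≡ y × y ≡ z
sunflower-trivial sunflowerFree uniform {x} {y} {z} x∈F y∈F z∈F (xy≡xz , xy≡yz)
  with ≡-dec Bool._≟_ x y | ≡-dec Bool._≟_ y z | ≡-dec Bool._≟_ x z
... | yes refl | yes refl | _        = refl , refl
... | yes refl | no  x≢z  | _        =
  contradiction (uniform-⊆⇒≡ uniform x∈F z∈F (p∩q≡p⇒p⊆q (trans (sym xy≡xz) (∩-idem x)))) x≢z
... | no  x≢y  | yes refl | _        =
  contradiction (sym (uniform-⊆⇒≡ uniform y∈F x∈F (p∩q≡p⇒p⊆q (trans (∩-comm y x) (trans xy≡yz (∩-idem y))))))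
                x≢y
... | no  x≢y  | no  _    | yes refl =
  contradiction (uniform-⊆⇒≡ uniform x∈F y∈F (p∩q≡p⇒p⊆q (trans xy≡xz (∩-idem x)))) x≢y
... | no  x≢y  | no  y≢z  | no  x≢z  =
  contradiction (xy≡xz , xy≡yz) (sunflowerFree x y z x∈F y∈F z∈F x≢y x≢z y≢z)

lookup-injective : ∀ {A : Set} {xs : List A} → Unique xs → ∀ {i j} → lookup xs i ≡ lookup xs j → i ≡ j
lookup-injective (_  ∷ _) {zero}  {zero}  _ = refl
lookup-injective (x∉ ∷ _) {zero}  {suc j} e = contradiction e (All.lookup x∉ (∈-lookup j))
lookup-injective (x∉ ∷ _) {suc i} {zero}  e = contradiction (sym e) (All.lookup x∉ (∈-lookup i))
lookup-injective (_  ∷ u) {suc i} {suc j} e = cong suc (lookup-injective u e)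

uniform-sunflowerFree-bound : ∀ {n k} (F : List (Subset n)) → Unique F → SunflowerFree F →
                              All (λ x → ∣ x ∣ ≡ k) F → length F ≤ binomSumThird n + binomSumThird n + binomSumThird n
uniform-sunflowerFree-bound {n} F unique sunflowerFree uniform =
  subst (λ r → length F ≤ r + r + r) (length-subsetsBelow n (suc (n / 3)))
        (diagonal-slice-rank (precompose (lookup F) (sunflowerTensor-decomposition n)) diagonal diagonal≢0)
  where
  T : Tensor (Fin (length F))
  T l m j = sunflowerTensor (lookup F l) (lookup F m) (lookup F j)
  diagonal : IsDiagonal T
  diagonal l m j T≢0 with sunflower-trivial sunflowerFree uniform (∈-lookup l) (∈-lookup m) (∈-lookup j)
                                             (sunflowerTensor≢0⇒sunflower _ _ _ T≢0)
  ... | l↦m , m↦j = lookup-injective unique l↦m , lookup-injective unique m↦j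
  diagonal≢0 : ∀ m → T m m m ≢ 0#
  diagonal≢0 m T≡0 = contradiction (trans (sym (sunflowerTensor-diagonal (lookup F m))) T≡0) λ ()

length-filter+length-filter-∁ : ∀ {A : Set} {P : Pred A 0ℓ} (P? : Decidable P) xs →
                                 length (filter P? xs) + length (filter (∁? P?) xs) ≡ length xs
length-filter+length-filter-∁ P? []       = refl
length-filter+length-filter-∁ P? (x ∷ xs) with ih ← length-filter+length-filter-∁ P? xs | does (P? x)
... | true  = cong suc ih
... | false = trans (ℕ.+-suc _ _) (cong suc ih)

module _ {A : Set} (size : A → ℕ) (Good : List A → Set)
         (filter-Good : ∀ {P : Pred A 0ℓ} (P? : Decidable P) {xs} → Good xs → Good (filter P? xs))
         (b : ℕ) (layer≤b : ∀ k {xs} → Good xs → All (λ x → size x ≡ k) xs → length xs ≤ b) where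

  length-by-layers : ∀ t {xs} → Good xs → All (λ x → size x < t) xs → length xs ≤ t * b
  length-by-layers zero    {[]}    _    _           = z≤n
  length-by-layers zero    {_ ∷ _} _    (() ∷ _)
  length-by-layers (suc t) {xs}    good size<1+t = begin
    length xs
      ≡⟨ length-filter+length-filter-∁ size≡t? xs ⟨
    length (filter size≡t? xs) + length (filter (∁? size≡t?) xs)
      ≤⟨ +-mono-≤ (layer≤b t (filter-Good size≡t? good) (all-filter size≡t? xs))
                  (length-by-layers t (filter-Good (∁? size≡t?) good) size<t) ⟩
    b + t * b
      ∎
    where
    open ℕ.≤-Reasoning
    size≡t? : Decidable (λ x → size x ≡ t)
    size≡t? x = size x ℕ.≟ t
    size<t : All (λ x → size x < t) (filter (∁? size≡t?) xs)
    size<t = All.tabulate λ x∈ → let x∈xs , size≢t = ∈-filter⁻ (∁? size≡t?) x∈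
                                 in ℕ.≤∧≢⇒< (ℕ.≤-pred (All.lookup size<1+t x∈xs)) size≢t

sunflowerFree-⊆ : ∀ {n} {F G : List (Subset n)} → (∀ {x} → x ∈ G → x ∈ F) → SunflowerFree F → SunflowerFree G
sunflowerFree-⊆ G⊆F sunflowerFree x y z x∈G y∈G z∈G =
  sunflowerFree x y z (G⊆F x∈G) (G⊆F y∈G) (G⊆F z∈G)

bound : Bound
bound n _ F unique sunflowerFree = begin
  length F             ≤⟨ length-by-layers ∣_∣ Good filter-Good (d + d + d) layer≤ (suc n) (unique , sunflowerFree) size<1+n ⟩
  suc n * (d + d + d)  ≡⟨ rearrange n d ⟩
  3 * (n + 1) * d      ∎
  where
  open ℕ.≤-Reasoning
  d : ℕ
  d = binomSumThird n
  Good : List (Subset n) → Set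
  Good G = Unique G × SunflowerFree G
  filter-Good : ∀ {P : Pred (Subset n) 0ℓ} (P? : Decidable P) {G} → Good G → Good (filter P? G)
  filter-Good P? (unique , sunflowerFree) =
    Unique.filter⁺ P? unique , sunflowerFree-⊆ (proj₁ ∘ ∈-filter⁻ P?) sunflowerFree
  layer≤ : ∀ k {G} → Good G → All (λ x → ∣ x ∣ ≡ k) G → length G ≤ d + d + d
  layer≤ k (unique , sunflowerFree) = uniform-sunflowerFree-bound _ unique sunflowerFree
  size<1+n : All (λ x → ∣ x ∣ < suc n) F
  size<1+n = All.tabulate λ {x} _ → s≤s (∣p∣≤n x)
  rearrange : ∀ n d → suc n * (d + d + d) ≡ 3 * (n + 1) * d
  rearrange = ℕ.solve-∀

-- Growth rates

^-distribʳ-* : ∀ m n k → (m * n) ^ k ≡ m ^ k * n ^ k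
^-distribʳ-* m n zero    = refl
^-distribʳ-* m n (suc k) = trans (cong (m * n *_) (^-distribʳ-* m n k)) (*-interchange m n (m ^ k) (n ^ k))

^-swap : ∀ x m n → (x ^ m) ^ n ≡ (x ^ n) ^ m
^-swap x m n = trans (ℕ.^-*-assoc x m n) (trans (cong (x ^_) (ℕ.*-comm m n)) (sym (ℕ.^-*-assoc x n m)))

partialRowSum-bound : ∀ n t → partialRowSum n t * 2 ^ suc n ≤ 3 ^ n * 2 ^ t
partialRowSum-bound n       zero    = z≤n
partialRowSum-bound zero    (suc t) = begin
  partialRowSum 0 (suc t) * 2  ≡⟨ cong (_* 2) (partialRowSum-0 t) ⟩
  2 * 1                        ≤⟨ *-monoʳ-≤ 2 (ℕ.m^n>0 2 t) ⟩
  2 * 2 ^ t                    ≡⟨ ℕ.*-identityˡ (2 * 2 ^ t) ⟨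
  1 * (2 * 2 ^ t)              ∎
  where open ℕ.≤-Reasoning
partialRowSum-bound (suc n) (suc t) = begin
  partialRowSum (suc n) (suc t) * 2 ^ suc (suc n)
    ≡⟨ cong (_* 2 ^ suc (suc n)) (partialRowSum-pascal n t) ⟩
  (partialRowSum n t + partialRowSum n (suc t)) * (2 * 2 ^ suc n)
    ≡⟨ distribute (partialRowSum n t) (partialRowSum n (suc t)) (2 ^ suc n) ⟩
  2 * (partialRowSum n t * 2 ^ suc n) + 2 * (partialRowSum n (suc t) * 2 ^ suc n)
    ≤⟨ +-mono-≤ (*-monoʳ-≤ 2 (partialRowSum-bound n t)) (*-monoʳ-≤ 2 (partialRowSum-bound n (suc t))) ⟩
  2 * (3 ^ n * 2 ^ t) + 2 * (3 ^ n * (2 * 2 ^ t))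
    ≡⟨ collect (3 ^ n) (2 ^ t) ⟩
  3 ^ suc n * 2 ^ suc t
    ∎
  where
  open ℕ.≤-Reasoning
  distribute : ∀ x y z → (x + y) * (2 * z) ≡ 2 * (x * z) + 2 * (y * z)
  distribute = ℕ.solve-∀
  collect : ∀ p w → 2 * (p * w) + 2 * (p * (2 * w)) ≡ 3 * p * (2 * w)
  collect = ℕ.solve-∀

-- That is, binomSumThird n ≤ (3 / 2^(2/3))^n. Here and below, identities for the ring solver
-- are stated with powers written out as products, which _^_ unfolds to.
binomSumThird-bound : ∀ n → binomSumThird n ^ 3 * 4 ^ n ≤ 27 ^ n
binomSumThird-bound n = ℕ.*-cancelʳ-≤ _ _ (2 ^ n) {{ℕ.m^n≢0 2 n}} (begin
  B ^ 3 * 4 ^ n * 2 ^ n            ≡⟨ cong (λ x → B ^ 3 * x * 2 ^ n) (^-distribʳ-* 2 2 n) ⟩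
  B ^ 3 * (2 ^ n * 2 ^ n) * 2 ^ n  ≡⟨ cube B (2 ^ n) ⟩
  (B * 2 ^ n) ^ 3                  ≤⟨ ^-monoˡ-≤ 3 B*2ⁿ≤3ⁿ*2^q ⟩
  (3 ^ n * 2 ^ q) ^ 3              ≡⟨ ^-distribʳ-* (3 ^ n) (2 ^ q) 3 ⟩
  (3 ^ n) ^ 3 * (2 ^ q) ^ 3        ≤⟨ *-monoʳ-≤ ((3 ^ n) ^ 3) 8^q≤2ⁿ ⟩
  (3 ^ n) ^ 3 * 2 ^ n              ≡⟨ cong (_* 2 ^ n) (^-swap 3 n 3) ⟩
  27 ^ n * 2 ^ n                   ∎)
  where
  open ℕ.≤-Reasoning
  q B : ℕ
  q = n / 3
  B = binomSumThird n
  cube : ∀ b w → b * (b * (b * 1)) * (w * w) * w ≡ b * w * (b * w * (b * w * 1))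
  cube = ℕ.solve-∀
  double : ∀ x y → 2 * (x * y) ≡ x * (2 * y)
  double = ℕ.solve-∀
  B*2ⁿ≤3ⁿ*2^q : B * 2 ^ n ≤ 3 ^ n * 2 ^ q
  B*2ⁿ≤3ⁿ*2^q = ℕ.*-cancelˡ-≤ 2 (begin
    2 * (B * 2 ^ n)        ≡⟨ double B (2 ^ n) ⟩
    B * (2 * 2 ^ n)        ≤⟨ partialRowSum-bound n (suc q) ⟩
    3 ^ n * (2 * 2 ^ q)    ≡⟨ double (3 ^ n) (2 ^ q) ⟨
    2 * (3 ^ n * 2 ^ q)    ∎)
  8^q≤2ⁿ : (2 ^ q) ^ 3 ≤ 2 ^ n
  8^q≤2ⁿ = ≤-trans (≤-reflexive (ℕ.^-*-assoc 2 q 3)) (^-monoʳ-≤ 2 (m/n*n≤m n 3))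

bernoulli : ∀ a k → (a + k) * a ^ k ≤ a * suc a ^ k
bernoulli a zero    = ≤-reflexive (cong (_* 1) (ℕ.+-identityʳ a))
bernoulli a (suc k) = begin
  (a + suc k) * (a * a ^ k)                  ≡⟨ split a k (a ^ k) ⟩
  a * ((a + k) * a ^ k) + a * a ^ k          ≤⟨ ℕ.+-monoʳ-≤ _ (*-monoˡ-≤ (a ^ k) (ℕ.m≤m+n a k)) ⟩
  a * ((a + k) * a ^ k) + (a + k) * a ^ k    ≡⟨ ℕ.+-comm (a * ((a + k) * a ^ k)) ((a + k) * a ^ k) ⟩
  suc a * ((a + k) * a ^ k)                  ≤⟨ *-monoʳ-≤ (suc a) (bernoulli a k) ⟩
  suc a * (a * suc a ^ k)                    ≡⟨ swap a (suc a ^ k) ⟩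
  a * suc a ^ suc k                          ∎
  where
  open ℕ.≤-Reasoning
  split : ∀ a k p → (a + suc k) * (a * p) ≡ a * ((a + k) * p) + a * p
  split = ℕ.solve-∀
  swap : ∀ a p → suc a * (a * p) ≡ a * (suc a * p)
  swap = ℕ.solve-∀

bernoulli⁴ : ∀ a k r → (a + k) ^ 4 * a ^ (r + k * 4) ≤ a ^ 4 * suc a ^ (r + k * 4)
bernoulli⁴ a k r = begin
  (a + k) ^ 4 * a ^ (r + k * 4)          ≡⟨ cong ((a + k) ^ 4 *_) (split a) ⟩
  (a + k) ^ 4 * (a ^ r * (a ^ k) ^ 4)    ≡⟨ regroup (a + k) (a ^ k) (a ^ r) ⟩
  ((a + k) * a ^ k) ^ 4 * a ^ r          ≤⟨ *-mono-≤ (^-monoˡ-≤ 4 (bernoulli a k)) (^-monoˡ-≤ r (ℕ.n≤1+n a)) ⟩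
  (a * suc a ^ k) ^ 4 * suc a ^ r        ≡⟨ regroup a (suc a ^ k) (suc a ^ r) ⟨
  a ^ 4 * (suc a ^ r * (suc a ^ k) ^ 4)  ≡⟨ cong (a ^ 4 *_) (split (suc a)) ⟨
  a ^ 4 * suc a ^ (r + k * 4)            ∎
  where
  open ℕ.≤-Reasoning
  split : ∀ x → x ^ (r + k * 4) ≡ x ^ r * (x ^ k) ^ 4
  split x = trans (ℕ.^-distribˡ-+-* x r (k * 4)) (cong (x ^ r *_) (sym (ℕ.^-*-assoc x k 4)))
  regroup : ∀ x p s → x * (x * (x * (x * 1))) * (s * (p * (p * (p * (p * 1)))))
                    ≡ x * p * (x * p * (x * p * (x * p * 1))) * s
  regroup = ℕ.solve-∀

cubic≤exponential-at : ∀ a c .{{_ : NonZero a}} k r → r < 4 → 512 * c * a ^ 4 < k →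
                       c * (r + k * 4 + 1) ^ 3 * a ^ (r + k * 4) ≤ suc a ^ (r + k * 4)
cubic≤exponential-at a c k r r<4 K<k = ℕ.*-cancelˡ-≤ (a ^ 4) {{ℕ.m^n≢0 a 4}} (begin
  a ^ 4 * (c * (n + 1) ^ 3 * a ^ n)  ≡⟨ move (a ^ 4) (c * (n + 1) ^ 3) (a ^ n) ⟩
  c * (n + 1) ^ 3 * a ^ 4 * a ^ n    ≤⟨ *-monoˡ-≤ (a ^ n) cubic≤k⁴ ⟩
  k ^ 4 * a ^ n                      ≤⟨ *-monoˡ-≤ (a ^ n) (^-monoˡ-≤ 4 (ℕ.m≤n+m k a)) ⟩
  (a + k) ^ 4 * a ^ n                ≤⟨ bernoulli⁴ a k r ⟩
  a ^ 4 * suc a ^ n                  ∎)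
  where
  open ℕ.≤-Reasoning
  n : ℕ
  n = r + k * 4
  move : ∀ x p y → x * (p * y) ≡ p * x * y
  move = ℕ.solve-∀
  double : ∀ k → k * 4 + k * 4 ≡ 8 * k
  double = ℕ.solve-∀
  expand : ∀ c k x → c * (8 * k * (8 * k * (8 * k * 1))) * x ≡ 512 * c * x * (k * (k * (k * 1)))
  expand = ℕ.solve-∀
  n+1≤8k : n + 1 ≤ 8 * k
  n+1≤8k = begin
    r + k * 4 + 1  ≡⟨ ℕ.+-comm (r + k * 4) 1 ⟩
    suc r + k * 4  ≤⟨ ℕ.+-monoˡ-≤ (k * 4) r<4 ⟩
    4 + k * 4      ≤⟨ ℕ.+-monoˡ-≤ (k * 4) (*-monoˡ-≤ 4 (≤-trans (s≤s z≤n) K<k)) ⟩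
    k * 4 + k * 4  ≡⟨ double k ⟩
    8 * k          ∎
  cubic≤k⁴ : c * (n + 1) ^ 3 * a ^ 4 ≤ k ^ 4
  cubic≤k⁴ = begin
    c * (n + 1) ^ 3 * a ^ 4  ≤⟨ *-monoˡ-≤ (a ^ 4) (*-monoʳ-≤ c (^-monoˡ-≤ 3 n+1≤8k)) ⟩
    c * (8 * k) ^ 3 * a ^ 4  ≡⟨ expand c k (a ^ 4) ⟩
    512 * c * a ^ 4 * k ^ 3  ≤⟨ *-monoˡ-≤ (k ^ 3) (ℕ.<⇒≤ K<k) ⟩
    k ^ 4                    ∎

cubic≤exponential : ∀ a c .{{_ : NonZero a}} → ∃[ N ] ∀ n → N ≤ n → c * (n + 1) ^ 3 * a ^ n ≤ suc a ^ n
cubic≤exponential a c = suc K * 4 , λ n N≤n →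
  subst (λ n → c * (n + 1) ^ 3 * a ^ n ≤ suc a ^ n) (sym (m≡m%n+[m/n]*n n 4))
        (cubic≤exponential-at a c (n / 4) (n % 4) (m%n<n n 4) (K<n/4 n N≤n))
  where
  K : ℕ
  K = 512 * c * a ^ 4
  K<n/4 : ∀ n → suc K * 4 ≤ n → K < n / 4
  K<n/4 n N≤n = subst (_≤ n / 4) (m*n/n≡m (suc K) 4) (/-monoˡ-≤ 4 N≤n)

cube-cancel : ∀ {x y} → x ^ 3 ≤ y ^ 3 → x ≤ y
cube-cancel x³≤y³ = ℕ.≮⇒≥ λ y<x → ℕ.<⇒≱ (ℕ.^-monoˡ-< 3 y<x) x³≤y³

muBound : MuBound
muBound m d d>0 27d³<4m³ = suc N , λ n N<n F unique sunflowerFree →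
  cube-cancel (ℕ.*-cancelʳ-≤ _ _ (4 ^ n) {{ℕ.m^n≢0 4 n}}
    (cubed n N<n (binomSumThird-bound n) (bound n (≤-trans (s≤s z≤n) N<n) F unique sunflowerFree)))
  where
  instance
    27d³≢0 : NonZero (27 * d ^ 3)
    27d³≢0 = ℕ.m*n≢0 27 (d ^ 3) {{_}} {{ℕ.m^n≢0 d 3 {{ℕ.>-nonZero d>0}}}}
  N : ℕ
  N = proj₁ (cubic≤exponential (27 * d ^ 3) 27)
  dominated : ∀ n → N ≤ n → 27 * (n + 1) ^ 3 * (27 * d ^ 3) ^ n ≤ suc (27 * d ^ 3) ^ n
  dominated = proj₂ (cubic≤exponential (27 * d ^ 3) 27)
  expand : ∀ p b w f → 3 * p * b * w * (3 * p * b * w * (3 * p * b * w * 1)) * f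
                     ≡ 27 * (p * (p * (p * 1))) * (b * (b * (b * 1)) * f) * (w * (w * (w * 1)))
  expand = ℕ.solve-∀
  cubed : ∀ n {L B} → N < n → B ^ 3 * 4 ^ n ≤ 27 ^ n → L ≤ 3 * (n + 1) * B →
          (L * d ^ n) ^ 3 * 4 ^ n ≤ (m ^ n) ^ 3 * 4 ^ n
  cubed n {L} {B} N<n B-bound L≤ = begin
    (L * d ^ n) ^ 3 * 4 ^ n
      ≤⟨ *-monoˡ-≤ (4 ^ n) (^-monoˡ-≤ 3 (*-monoˡ-≤ (d ^ n) L≤)) ⟩
    (3 * (n + 1) * B * d ^ n) ^ 3 * 4 ^ n
      ≡⟨ expand (n + 1) B (d ^ n) (4 ^ n) ⟩
    27 * (n + 1) ^ 3 * (B ^ 3 * 4 ^ n) * (d ^ n) ^ 3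
      ≤⟨ *-monoˡ-≤ ((d ^ n) ^ 3) (*-monoʳ-≤ (27 * (n + 1) ^ 3) B-bound) ⟩
    27 * (n + 1) ^ 3 * 27 ^ n * (d ^ n) ^ 3
      ≡⟨ ℕ.*-assoc (27 * (n + 1) ^ 3) (27 ^ n) ((d ^ n) ^ 3) ⟩
    27 * (n + 1) ^ 3 * (27 ^ n * (d ^ n) ^ 3)
      ≡⟨ cong (27 * (n + 1) ^ 3 *_) (trans (cong (27 ^ n *_) (^-swap d n 3)) (sym (^-distribʳ-* 27 (d ^ 3) n))) ⟩
    27 * (n + 1) ^ 3 * (27 * d ^ 3) ^ n
      ≤⟨ dominated n (ℕ.<⇒≤ N<n) ⟩
    suc (27 * d ^ 3) ^ n
      ≤⟨ ^-monoˡ-≤ n 27d³<4m³ ⟩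
    (4 * m ^ 3) ^ n
      ≡⟨ trans (^-distribʳ-* 4 (m ^ 3) n) (cong (4 ^ n *_) (^-swap m 3 n)) ⟩
    4 ^ n * (m ^ n) ^ 3
      ≡⟨ ℕ.*-comm (4 ^ n) ((m ^ n) ^ 3) ⟩
    (m ^ n) ^ 3 * 4 ^ n
      ∎
    where open ℕ.≤-Reasoning

theorem1p3 : Bound × MuBound
theorem1p3 = bound , muBound
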